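{- Let $n\leq N$ be positive integers. A family $\mathcal{S}\subseteq 2^{[N]}$ forms a copy of $2^{[n]}$ (under inclusion) if and only if there exist a set $I\subseteq[N]$ with $|I|=n$ and an inclusion-preserving map $\phi:2^I\to 2^{[N]\setminus I}$ (i.e., $Y\subseteq Y'$ implies $\phi(Y)\subseteq\phi(Y')$) such that $\mathcal{S}=\{Y\cup\phi(Y): Y\subseteq I\}$.
   Context: A family $\mathcal{S}\subseteq 2^{[N]}$ forms a copy of $2^{[n]}$ if $\mathcal{S}$ is the image of an injective map $f:2^{[n]}\to2^{[N]}$ with $A\subseteq B$ iff $f(A)\subseteq f(B)$. -}

module Defs where

open import Data.Nat using (ℕ)
open import Data.Fin.Subset using (Subset; _⊆_; _∪_; ∁; ∣_∣)
open import Data.Product using (Σ; ∃; _×_; _,_)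
open import Relation.Binary.PropositionalEquality using (_≡_)
open import Relation.Unary using (Pred)
open import Level using (0ℓ)
open import Function.Bundles using (_⇔_)
open import Function.Definitions using (Injective)

Family : ℕ → Set₁
Family N = Pred (Subset N) 0ℓ

IsCopyOf : (n : ℕ) {N : ℕ} → Family N → Set
IsCopyOf n {N} 𝒮 =
  Σ (Subset n → Subset N) λ f →
    Injective _≡_ _≡_ f
    × (∀ A B → (A ⊆ B) ⇔ (f A ⊆ f B))
    × (∀ X → 𝒮 X ⇔ ∃ λ A → f A ≡ X)

-- An element of 2^I is a subset Y of [N] together with a proof Y ⊆ I.
HasCubeForm : (n : ℕ) {N : ℕ} → Family N → Set
HasCubeForm n {N} 𝒮 =
  Σ (Subset N) λ I →
    ∣ I ∣ ≡ n
    × Σ ((Y : Subset N) → Y ⊆ I → Subset N) λ φ →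
        (∀ Y (p : Y ⊆ I) → φ Y p ⊆ ∁ I)
        × (∀ Y Y′ (p : Y ⊆ I) (p′ : Y′ ⊆ I) → Y ⊆ Y′ → φ Y p ⊆ φ Y′ p′)
        × (∀ X → 𝒮 X ⇔ ∃ λ Y → Σ (Y ⊆ I) λ p → Y ∪ φ Y p ≡ X)

-- An order embedding f of 2^[n] has, for every coordinate i, a point x i of
-- f {i} outside f ([n] ∖ {i}); monotonicity then gives x i ∈ f A ⇔ i ∈ A.
-- So I = {x i} has n elements, f A ∩ I records A, and the rest f A ∖ I is a
-- monotone function φ of f A ∩ I. Conversely, given I and φ, the map
-- A ↦ A ∪ φ A (reading A ⊆ I as a subset of [|I|]) is an order embedding,
-- because intersecting with I recovers A.
module Submission where

open import Defs
open import Data.Bool using (true; false)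
open import Data.Bool.Properties using (∨-identityʳ)
open import Data.Empty using (⊥-elim)
open import Data.Fin using (Fin; zero; suc)
open import Data.Fin.Properties using (¬∀⟶∃¬; suc-injective)
open import Data.Fin.Subset
open import Data.Fin.Subset.Properties
open import Data.Nat using (ℕ; _≤_; suc)
open import Data.Product using (Σ; ∃; _×_; _,_; proj₁; proj₂)
open import Data.Sum using (inj₁; inj₂)
open import Data.Vec using (_∷_; []; tabulate; lookup; here)
open import Data.Vec.Properties using (lookup⇒[]=; []=⇒lookup; lookup∘tabulate)
open import Function using (id; const; _∘_)
open import Function.Bundles using (_⇔_; mk⇔; Equivalence)
open import Function.Definitions using (Injective)
open import Relation.Binary.PropositionalEquality
  using (_≡_; refl; sym; trans; cong; cong₂; subst; subst₂; module ≡-Reasoning)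
open import Relation.Nullary using (¬_)
open import Relation.Nullary.Decidable using (decidable-stable; _→-dec_)

open Equivalence

private
  variable
    n N : ℕ
    p p′ q q′ : Subset N
    x : Fin N

∪-mono-⊆ : p ⊆ p′ → q ⊆ q′ → p ∪ q ⊆ p′ ∪ q′
∪-mono-⊆ {p = p} {q = q} p⊆p′ q⊆q′ x∈p∪q with x∈p∪q⁻ p q x∈p∪q
... | inj₁ x∈p = x∈p∪q⁺ (inj₁ (p⊆p′ x∈p))
... | inj₂ x∈q = x∈p∪q⁺ (inj₂ (q⊆q′ x∈q))

∩-monoˡ-⊆ : p ⊆ p′ → p ∩ q ⊆ p′ ∩ q
∩-monoˡ-⊆ {p = p} {q = q} p⊆p′ x∈p∩q with x∈p∩q⁻ p q x∈p∩q
... | x∈p , x∈q = x∈p∩q⁺ (p⊆p′ x∈p , x∈q)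

p∩q∪p∩∁q≡p : (p q : Subset N) → (p ∩ q) ∪ (p ∩ ∁ q) ≡ p
p∩q∪p∩∁q≡p p q = begin
  (p ∩ q) ∪ (p ∩ ∁ q) ≡⟨ sym (∩-distribˡ-∪ p q (∁ q)) ⟩
  p ∩ (q ∪ ∁ q)       ≡⟨ cong (p ∩_) (p∪∁p≡⊤ q) ⟩
  p ∩ ⊤               ≡⟨ ∩-identityʳ p ⟩
  p                   ∎
  where open ≡-Reasoning

x∈p⇒⁅x⁆⊆p : x ∈ p → ⁅ x ⁆ ⊆ p
x∈p⇒⁅x⁆⊆p {x = x} {p = p} x∈p y∈⁅x⁆ = subst (_∈ p) (sym (x∈⁅y⁆⇒x≡y x y∈⁅x⁆)) x∈p

x∉p⇒p⊆∁⁅x⁆ : x ∉ p → p ⊆ ∁ ⁅ x ⁆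
x∉p⇒p⊆∁⁅x⁆ {x = x} {p = p} x∉p y∈p =
  x∉p⇒x∈∁p (λ y∈⁅x⁆ → x∉p (subst (_∈ p) (x∈⁅y⁆⇒x≡y x y∈⁅x⁆) y∈p))

p⊈q⇒∃x∈p∧x∉q : ¬ (p ⊆ q) → ∃ λ x → x ∈ p × x ∉ q
p⊈q⇒∃x∈p∧x∉q {p = p} {q = q} p⊈q
  with x , ¬[x∈p⇒x∈q] ← ¬∀⟶∃¬ _ (λ x → x ∈ p → x ∈ q)
                                (λ x → x ∈? p →-dec x ∈? q) (λ p⊆q → p⊈q (p⊆q _))
  = x , decidable-stable (x ∈? p) (λ x∉p → ¬[x∈p⇒x∈q] (⊥-elim ∘ x∉p))
      , ¬[x∈p⇒x∈q] ∘ const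

∣⁅x⁆∪p∣≡1+∣p∣ : (x : Fin N) (p : Subset N) → x ∉ p → ∣ ⁅ x ⁆ ∪ p ∣ ≡ suc ∣ p ∣
∣⁅x⁆∪p∣≡1+∣p∣ zero    (true  ∷ p) x∉p = ⊥-elim (x∉p here)
∣⁅x⁆∪p∣≡1+∣p∣ zero    (false ∷ p) x∉p = cong (suc ∘ ∣_∣) (∪-identityˡ p)
∣⁅x⁆∪p∣≡1+∣p∣ (suc x) (true  ∷ p) x∉p = cong suc (∣⁅x⁆∪p∣≡1+∣p∣ x p (drop-not-there x∉p))
∣⁅x⁆∪p∣≡1+∣p∣ (suc x) (false ∷ p) x∉p = ∣⁅x⁆∪p∣≡1+∣p∣ x p (drop-not-there x∉p)

IsOrderEmbedding : (Subset n → Subset N) → Set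
IsOrderEmbedding f = ∀ A B → A ⊆ B ⇔ f A ⊆ f B

orderEmbedding⇒injective : {f : Subset n → Subset N} →
  IsOrderEmbedding f → Injective _≡_ _≡_ f
orderEmbedding⇒injective f-emb {A} {B} fA≡fB =
  ⊆-antisym (from (f-emb A B) (⊆-reflexive fA≡fB))
            (from (f-emb B A) (⊆-reflexive (sym fA≡fB)))

image : (Fin n → Fin N) → Subset N
image {n = 0}     xs = ⊥
image {n = suc n} xs = ⁅ xs zero ⁆ ∪ image (xs ∘ suc)

xs[i]∈image : (xs : Fin n → Fin N) (i : Fin n) → xs i ∈ image xs
xs[i]∈image xs zero    = x∈p∪q⁺ (inj₁ (x∈⁅x⁆ (xs zero)))
xs[i]∈image xs (suc i) = x∈p∪q⁺ (inj₂ (xs[i]∈image (xs ∘ suc) i))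

∈image⇒∃ : (xs : Fin n → Fin N) → x ∈ image xs → ∃ λ i → xs i ≡ x
∈image⇒∃ {n = 0}     xs x∈⊥ = ⊥-elim (∉⊥ x∈⊥)
∈image⇒∃ {n = suc n} xs x∈img with x∈p∪q⁻ ⁅ xs zero ⁆ _ x∈img
... | inj₁ x∈⁅xs0⁆ = zero , sym (x∈⁅y⁆⇒x≡y _ x∈⁅xs0⁆)
... | inj₂ x∈rest with i , xs[1+i]≡x ← ∈image⇒∃ (xs ∘ suc) x∈rest = suc i , xs[1+i]≡x

∣image∣≡n : (xs : Fin n → Fin N) → Injective _≡_ _≡_ xs → ∣ image xs ∣ ≡ n
∣image∣≡n {n = 0} {N = N} xs _ = ∣⊥∣≡0 N
∣image∣≡n {n = suc n} xs xs-inj =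
  trans (∣⁅x⁆∪p∣≡1+∣p∣ (xs zero) _ xs0∉rest)
        (cong suc (∣image∣≡n (xs ∘ suc) (suc-injective ∘ xs-inj)))
  where
  xs0∉rest : xs zero ∉ image (xs ∘ suc)
  xs0∉rest xs0∈rest with i , xs[1+i]≡xs0 ← ∈image⇒∃ (xs ∘ suc) xs0∈rest
    with () ← xs-inj xs[1+i]≡xs0

preimage : (Fin n → Fin N) → Subset N → Subset n
preimage xs p = tabulate (lookup p ∘ xs)

∈-preimage : (xs : Fin n → Fin N) {i : Fin n} → i ∈ preimage xs p ⇔ xs i ∈ p
∈-preimage {p = p} xs {i} = mk⇔
  (λ i∈ → lookup⇒[]= (xs i) p (trans (sym (lookup∘tabulate _ i)) ([]=⇒lookup i∈)))
  (λ xs[i]∈p → lookup⇒[]= i _ (trans (lookup∘tabulate _ i) ([]=⇒lookup xs[i]∈p)))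

-- A subset of I ⊆ [N] is coded as a subset of [∣ I ∣] by its entries at the positions of I.

embed : (I : Subset N) → Subset ∣ I ∣ → Subset N
embed []          A       = []
embed (true  ∷ I) (a ∷ A) = a ∷ embed I A
embed (false ∷ I) A       = false ∷ embed I A

restrict : (I : Subset N) → Subset N → Subset ∣ I ∣
restrict []          []      = []
restrict (true  ∷ I) (y ∷ Y) = y ∷ restrict I Y
restrict (false ∷ I) (y ∷ Y) = restrict I Y

restrict-embed : (I : Subset N) (A : Subset ∣ I ∣) → restrict I (embed I A) ≡ A
restrict-embed []          []      = refl
restrict-embed (true  ∷ I) (a ∷ A) = cong (a ∷_) (restrict-embed I A)
restrict-embed (false ∷ I) A       = restrict-embed I A

embed-restrict : (I Y : Subset N) → Y ⊆ I → embed I (restrict I Y) ≡ Y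
embed-restrict []          []          _   = refl
embed-restrict (true  ∷ I) (y     ∷ Y) Y⊆I = cong (y ∷_) (embed-restrict I Y (drop-∷-⊆ Y⊆I))
embed-restrict (false ∷ I) (false ∷ Y) Y⊆I = cong (false ∷_) (embed-restrict I Y (drop-∷-⊆ Y⊆I))
embed-restrict (false ∷ I) (true  ∷ Y) Y⊆I with () ← Y⊆I here

embed⊆ : (I : Subset N) (A : Subset ∣ I ∣) → embed I A ⊆ I
embed⊆ []          []          ()
embed⊆ (true  ∷ I) (true  ∷ A) = in⊆in (embed⊆ I A)
embed⊆ (true  ∷ I) (false ∷ A) = out⊆ (embed⊆ I A)
embed⊆ (false ∷ I) A           = out⊆ (embed⊆ I A)

embed-mono : (I : Subset N) {A B : Subset ∣ I ∣} → A ⊆ B → embed I A ⊆ embed I B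
embed-mono []          {[]}    {[]}    _   = id
embed-mono (true  ∷ I) {false ∷ A} {_     ∷ B} A⊆B = out⊆ (embed-mono I (drop-∷-⊆ A⊆B))
embed-mono (true  ∷ I) {true  ∷ A} {true  ∷ B} A⊆B = in⊆in (embed-mono I (drop-∷-⊆ A⊆B))
embed-mono (true  ∷ I) {true  ∷ A} {false ∷ B} A⊆B with () ← A⊆B here
embed-mono (false ∷ I) A⊆B = out⊆ (embed-mono I A⊆B)

restrict-mono : (I : Subset N) {Y Z : Subset N} → Y ⊆ Z → restrict I Y ⊆ restrict I Z
restrict-mono []          {[]}    {[]}    _   = id
restrict-mono (true  ∷ I) {false ∷ Y} {_     ∷ Z} Y⊆Z = out⊆ (restrict-mono I (drop-∷-⊆ Y⊆Z))
restrict-mono (true  ∷ I) {true  ∷ Y} {true  ∷ Z} Y⊆Z = in⊆in (restrict-mono I (drop-∷-⊆ Y⊆Z))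
restrict-mono (true  ∷ I) {true  ∷ Y} {false ∷ Z} Y⊆Z with () ← Y⊆Z here
restrict-mono (false ∷ I) {y ∷ Y} {z ∷ Z} Y⊆Z = restrict-mono I (drop-∷-⊆ Y⊆Z)

restrict-∪-outside : (I Y Z : Subset N) → Z ⊆ ∁ I → restrict I (Y ∪ Z) ≡ restrict I Y
restrict-∪-outside []          []      []          _ = refl
restrict-∪-outside (true  ∷ I) (y ∷ Y) (true  ∷ Z) Z⊆∁I with () ← Z⊆∁I here
restrict-∪-outside (true  ∷ I) (y ∷ Y) (false ∷ Z) Z⊆∁I =
  cong₂ _∷_ (∨-identityʳ y) (restrict-∪-outside I Y Z (drop-∷-⊆ Z⊆∁I))
restrict-∪-outside (false ∷ I) (y ∷ Y) (z ∷ Z) Z⊆∁I =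
  restrict-∪-outside I Y Z (drop-∷-⊆ Z⊆∁I)

cubeForm⇒copy : {𝒮 : Family N} → HasCubeForm n 𝒮 → IsCopyOf n 𝒮
cubeForm⇒copy {N = N} {𝒮 = 𝒮} (I , refl , φ , φ⊆∁I , φ-mono , 𝒮≐cube) =
  cube , orderEmbedding⇒injective cube-emb , cube-emb , 𝒮≐image
  where
  cube : Subset ∣ I ∣ → Subset N
  cube A = embed I A ∪ φ (embed I A) (embed⊆ I A)

  restrict-cube : ∀ A → restrict I (cube A) ≡ A
  restrict-cube A = trans (restrict-∪-outside I _ _ (φ⊆∁I _ _)) (restrict-embed I A)

  cube-mono : ∀ {A B} → A ⊆ B → cube A ⊆ cube B
  cube-mono {A} {B} A⊆B = ∪-mono-⊆ eA⊆eB (φ-mono _ _ _ _ eA⊆eB)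
    where
    eA⊆eB : embed I A ⊆ embed I B
    eA⊆eB = embed-mono I A⊆B

  cube-emb : IsOrderEmbedding cube
  cube-emb A B = mk⇔ cube-mono
    (λ cubeA⊆cubeB → subst₂ _⊆_ (restrict-cube A) (restrict-cube B) (restrict-mono I cubeA⊆cubeB))

  -- φ Y p does not depend on p, as φ is monotone in both directions along Y ⊆ Y.
  ∪φ-cong : ∀ {Y Z} (p : Y ⊆ I) (q : Z ⊆ I) → Y ≡ Z → Y ∪ φ Y p ≡ Z ∪ φ Z q
  ∪φ-cong p q refl = cong (_ ∪_) (⊆-antisym (φ-mono _ _ p q id) (φ-mono _ _ q p id))

  𝒮≐image : ∀ X → 𝒮 X ⇔ ∃ λ A → cube A ≡ X
  𝒮≐image X = mk⇔
    (λ X∈𝒮 → let Y , Y⊆I , Y∪φY≡X = to (𝒮≐cube X) X∈𝒮 in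
      restrict I Y , trans (∪φ-cong _ Y⊆I (embed-restrict I Y Y⊆I)) Y∪φY≡X)
    (λ (A , cubeA≡X) → from (𝒮≐cube X) (embed I A , embed⊆ I A , cubeA≡X))

coordinates : {f : Subset n → Subset N} → IsOrderEmbedding f →
  ∃ λ (xs : Fin n → Fin N) → ∀ A i → xs i ∈ f A ⇔ i ∈ A
coordinates {f = f} f-emb = (λ i → proj₁ (witness i)) , λ A i → coordinate A i (proj₂ (witness i))
  where
  witness : ∀ i → ∃ λ y → y ∈ f ⁅ i ⁆ × y ∉ f (∁ ⁅ i ⁆)
  witness i = p⊈q⇒∃x∈p∧x∉q λ f⁅i⁆⊆f∁⁅i⁆ →
    x∈∁p⇒x∉p (from (f-emb _ _) f⁅i⁆⊆f∁⁅i⁆ (x∈⁅x⁆ i)) (x∈⁅x⁆ i)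

  coordinate : ∀ A i {y} → y ∈ f ⁅ i ⁆ × y ∉ f (∁ ⁅ i ⁆) → y ∈ f A ⇔ i ∈ A
  coordinate A i (y∈f⁅i⁆ , y∉f∁⁅i⁆) = mk⇔
    (λ y∈fA → decidable-stable (i ∈? A) λ i∉A →
      y∉f∁⁅i⁆ (to (f-emb _ _) (x∉p⇒p⊆∁⁅x⁆ i∉A) y∈fA))
    (λ i∈A → to (f-emb _ _) (x∈p⇒⁅x⁆⊆p i∈A) y∈f⁅i⁆)

module _ {f : Subset n → Subset N} (f-emb : IsOrderEmbedding f)
         {xs : Fin n → Fin N} (xs-coord : ∀ A i → xs i ∈ f A ⇔ i ∈ A) where

  private
    I : Subset N
    I = image xs

    xs-injective : Injective _≡_ _≡_ xs
    xs-injective {i} {j} xs[i]≡xs[j] = sym (x∈⁅y⁆⇒x≡y i (to (xs-coord ⁅ i ⁆ j)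
      (subst (_∈ f ⁅ i ⁆) xs[i]≡xs[j] (from (xs-coord ⁅ i ⁆ i) (x∈⁅x⁆ i)))))

    preimage-∩I : ∀ A → preimage xs (f A ∩ I) ≡ A
    preimage-∩I A = ⊆-antisym
      (λ {i} i∈ → to (xs-coord A i) (proj₁ (x∈p∩q⁻ _ _ (to (∈-preimage xs) i∈))))
      (λ {i} i∈A → from (∈-preimage xs) (x∈p∩q⁺ (from (xs-coord A i) i∈A , xs[i]∈image xs i)))

    f-preimage-∩I : ∀ Y → Y ⊆ I → f (preimage xs Y) ∩ I ≡ Y
    f-preimage-∩I Y Y⊆I = ⊆-antisym ⊆Y Y⊆
      where
      ⊆Y : f (preimage xs Y) ∩ I ⊆ Y
      ⊆Y y∈ with y∈f , y∈I ← x∈p∩q⁻ _ _ y∈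
        with i , refl ← ∈image⇒∃ xs y∈I = to (∈-preimage xs) (to (xs-coord _ i) y∈f)
      Y⊆ : Y ⊆ f (preimage xs Y) ∩ I
      Y⊆ y∈Y with i , refl ← ∈image⇒∃ xs (Y⊆I y∈Y) =
        x∈p∩q⁺ (from (xs-coord _ i) (from (∈-preimage xs) y∈Y) , Y⊆I y∈Y)

    φ : (Y : Subset N) → Y ⊆ I → Subset N
    φ Y _ = f (preimage xs Y) ∩ ∁ I

    φ-mono : ∀ Y Y′ (p : Y ⊆ I) (p′ : Y′ ⊆ I) → Y ⊆ Y′ → φ Y p ⊆ φ Y′ p′
    φ-mono Y Y′ _ _ Y⊆Y′ = ∩-monoˡ-⊆ (to (f-emb _ _)
      (from (∈-preimage xs) ∘ Y⊆Y′ ∘ to (∈-preimage xs)))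

    ∩I⊆I : ∀ p → p ∩ I ⊆ I
    ∩I⊆I p = p∩q⊆q p I

    image-as-cube : ∀ A → (f A ∩ I) ∪ φ (f A ∩ I) (∩I⊆I (f A)) ≡ f A
    image-as-cube A = begin
      (f A ∩ I) ∪ (f (preimage xs (f A ∩ I)) ∩ ∁ I) ≡⟨ cong (λ B → (f A ∩ I) ∪ (f B ∩ ∁ I)) (preimage-∩I A) ⟩
      (f A ∩ I) ∪ (f A ∩ ∁ I)                       ≡⟨ p∩q∪p∩∁q≡p (f A) I ⟩
      f A                                           ∎
      where open ≡-Reasoning

    cube-as-image : ∀ Y (p : Y ⊆ I) → f (preimage xs Y) ≡ Y ∪ φ Y p
    cube-as-image Y Y⊆I = begin
      f (preimage xs Y)                                        ≡⟨ sym (p∩q∪p∩∁q≡p _ I) ⟩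
      (f (preimage xs Y) ∩ I) ∪ (f (preimage xs Y) ∩ ∁ I)     ≡⟨ cong (_∪ φ Y Y⊆I) (f-preimage-∩I Y Y⊆I) ⟩
      Y ∪ φ Y Y⊆I                                              ∎
      where open ≡-Reasoning

    image⇒cube : ∀ {X} → (∃ λ A → f A ≡ X) → ∃ λ Y → Σ (Y ⊆ I) λ p → Y ∪ φ Y p ≡ X
    image⇒cube (A , refl) = f A ∩ I , ∩I⊆I (f A) , image-as-cube A

    cube⇒image : ∀ {X} → (∃ λ Y → Σ (Y ⊆ I) λ p → Y ∪ φ Y p ≡ X) → ∃ λ A → f A ≡ X
    cube⇒image (Y , Y⊆I , refl) = preimage xs Y , cube-as-image Y Y⊆I

  cubeForm : {𝒮 : Family N} → (∀ X → 𝒮 X ⇔ ∃ λ A → f A ≡ X) → HasCubeForm n 𝒮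
  cubeForm 𝒮≐image = I , ∣image∣≡n xs xs-injective , φ , (λ Y _ → p∩q⊆q _ (∁ I)) , φ-mono ,
    λ X → mk⇔ (image⇒cube ∘ to (𝒮≐image X)) (from (𝒮≐image X) ∘ cube⇒image)

copy⇒cubeForm : {𝒮 : Family N} → IsCopyOf n 𝒮 → HasCubeForm n 𝒮
copy⇒cubeForm (f , _ , f-emb , 𝒮≐image) with _ , xs-coord ← coordinates f-emb =
  cubeForm f-emb xs-coord 𝒮≐image

theorem6 : (n N : ℕ) → 1 ≤ n → n ≤ N → (𝒮 : Family N) →
    IsCopyOf n 𝒮 ⇔ HasCubeForm n 𝒮
theorem6 _ _ _ _ _ = mk⇔ copy⇒cubeForm cubeForm⇒copy
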